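{- Let $M$ be a positroid on $[n]$ without coloops. Then for every proper subset $A\subsetneq[n]$, $\operatorname{rk}_M(A)\leq|A|-\operatorname{cw}_M(A)$.
   Context: For $i\in[n]$ the cyclic order $<_i$ is $i<_i i+1<_i\cdots<_i n<_i 1<_i\cdots<_i i-1$. A decorated permutation on $[n]$ is $(\pi,\operatorname{col})$, $\pi$ a permutation of $[n]$, $\operatorname{col}:[n]\to\{0,1,-1\}$ with $\operatorname{col}(i)=0$ iff $\pi(i)\neq i$; each positroid $M$ on $[n]$ corresponds to a unique decorated permutation (its bases are the sets $B$ with $I_i\le_i B$ in Gale order for all $i$, where $I_i=\{j: j<_i\pi^{ -1}(j)\text{ or }\operatorname{col}(j)=-1\}$), and coloops of $M$ are the $i$ with $\pi(i)=i$, $\operatorname{col}(i)=-1$. The CW-arrow starting at $i$ is $C_i=[n]$ if $\pi(i)=i$ and $\operatorname{col}(i)=-1$, and otherwise $C_i=\{j: j\leq_i\pi(i)\}$. The CW-function is $\operatorname{cw}_M(A)=|\{i: C_i\subseteq A\}|$ for $A\neq[n]$, and $\operatorname{cw}_M([n])=n-\operatorname{rk}_M([n])$. $\operatorname{rk}_M(S)=\max\{|S\cap B|: B\text{ a basis}\}$. -}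

module Defs where

open import Data.Bool using (Bool; true; false; _∧_; _∨_; not; if_then_else_)
open import Data.Nat using (ℕ; zero; suc; _+_; _∸_; _≤ᵇ_; _<ᵇ_; _≡ᵇ_; _⊔_)
open import Data.Fin using (Fin; toℕ)
open import Data.Fin.Permutation using (Permutation′; _⟨$⟩ʳ_; _⟨$⟩ˡ_)
open import Data.Fin.Subset using (Subset; ⊤; ⊥; ∣_∣; _∩_)
open import Data.Vec using (Vec; []; _∷_; lookup; tabulate)
open import Data.Bool.ListAction using (any)
open import Data.List using (List; []; _∷_; upTo; allFin; filterᵇ; length; map; foldr; _++_)
open import Data.Product using (_×_)
open import Relation.Binary.PropositionalEquality using (_≡_)
open import Relation.Nullary using (¬_)
open import Function.Bundles using (_⇔_)

data Col : Set where
  c0 c+1 c-1 : Col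

isMinus : Col → Bool
isMinus c-1 = true
isMinus _   = false

record DecPerm (n : ℕ) : Set where
  field
    π       : Permutation′ n
    col     : Fin n → Col
    col-spec : ∀ i → (col i ≡ c0) ⇔ (¬ (π ⟨$⟩ʳ i ≡ i))
open DecPerm public

-- Position of j in the cyclic order <_i  (i has position 0, i+1 position 1, ...)
pos : {n : ℕ} → Fin n → Fin n → ℕ
pos {n} i j = if toℕ i ≤ᵇ toℕ j then toℕ j ∸ toℕ i else (n ∸ toℕ i) + toℕ j

lt_ : {n : ℕ} → Fin n → Fin n → Fin n → Bool
lt_ i j k = pos i j <ᵇ pos i k

le_ : {n : ℕ} → Fin n → Fin n → Fin n → Bool
le_ i j k = pos i j ≤ᵇ pos i k

-- Elements of A listed in increasing <_i order, recorded by their <_i positions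
sortedPos : {n : ℕ} → Fin n → Subset n → List ℕ
sortedPos {n} i A = filterᵇ (λ p → any (λ j → lookup A j ∧ (pos i j ≡ᵇ p)) (allFin n)) (upTo n)

pointwiseLe : List ℕ → List ℕ → Bool
pointwiseLe [] [] = true
pointwiseLe (a ∷ as) (b ∷ bs) = (a ≤ᵇ b) ∧ pointwiseLe as bs
pointwiseLe _ _ = false

-- Gale order with respect to <_i :  A ≤_i B  (requires |A| = |B|)
galeLe : {n : ℕ} → Fin n → Subset n → Subset n → Bool
galeLe i A B = pointwiseLe (sortedPos i A) (sortedPos i B)

allB : {n : ℕ} → (Fin n → Bool) → Bool
allB {n} f = not (any (λ i → not (f i)) (allFin n))

Iset : {n : ℕ} → DecPerm n → Fin n → Subset n
Iset D i = tabulate (λ j → lt_ i j (π D ⟨$⟩ˡ j) ∨ isMinus (col D j))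

isBasis : {n : ℕ} → DecPerm n → Subset n → Bool
isBasis D B = allB (λ i → galeLe i (Iset D i) B)

allSubsets : (n : ℕ) → List (Subset n)
allSubsets zero = [] ∷ []
allSubsets (suc n) = map (true ∷_) (allSubsets n) ++ map (false ∷_) (allSubsets n)

rk : {n : ℕ} → DecPerm n → Subset n → ℕ
rk {n} D S = foldr (λ B m → (if isBasis D B then ∣ S ∩ B ∣ else 0) ⊔ m) 0 (allSubsets n)

isColoop : {n : ℕ} → DecPerm n → Fin n → Set
isColoop D i = (π D ⟨$⟩ʳ i ≡ i) × (col D i ≡ c-1)

isFixedMinus : {n : ℕ} → DecPerm n → Fin n → Bool
isFixedMinus D i = (toℕ (π D ⟨$⟩ʳ i) ≡ᵇ toℕ i) ∧ isMinus (col D i)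

Carrow : {n : ℕ} → DecPerm n → Fin n → Subset n
Carrow D i = if isFixedMinus D i then ⊤ else tabulate (λ j → le_ i j (π D ⟨$⟩ʳ i))

subsetB : {n : ℕ} → Subset n → Subset n → Bool
subsetB X A = allB (λ j → not (lookup X j) ∨ lookup A j)

isFullB : {n : ℕ} → Subset n → Bool
isFullB A = allB (λ j → lookup A j)

cw : {n : ℕ} → DecPerm n → Subset n → ℕ
cw {n} D A = if isFullB A then n ∸ rk D ⊤
             else length (filterᵇ (λ i → subsetB (Carrow D i) A) (allFin n))

-- Pick a ∉ A and measure positions cyclically from a.  Then A splits into maximal runs,
-- each beginning right after some e ∉ A.  A CW-arrow contained in A cannot pass a, so it is
-- an ordinary interval of positions, and one ending in the run that starts at s = e + 1
-- also starts in it (it cannot pass e).  Such an endpoint j therefore satisfies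
-- ¬ (j <ₛ π⁻¹ j), and as there are no coloops, j ∉ Iₛ.  The run is an initial segment of
-- <ₛ, so the Gale condition Iₛ ≤ₛ B gives |run ∩ B| ≤ |run ∩ Iₛ| ≤ |run| - #{arrows ⊆ A
-- ending in the run}.  Summing over the runs, |A ∩ B| + cw(A) ≤ |A| for every basis B.

module Submission where

open import Level using (0ℓ)
open import Function using (_∘_)
open import Function.Bundles using (Equivalence)
open import Data.Bool using (Bool; true; false; _∧_; _∨_; not; if_then_else_)
open import Data.Bool.Properties
  using (T-≡; ∧-assoc; ∧-comm; ∧-identityʳ; ∧-zeroʳ; ∧-conicalˡ; ∧-conicalʳ; ∨-identityʳ; not-¬)
open import Data.Bool.ListAction using (any)
open import Data.Empty using (⊥-elim)
open import Data.Product using (_×_; _,_; ∃; ∃₂)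
open import Data.Nat
open import Data.Nat.Properties
open import Data.Nat.Induction using (<-rec)
open import Data.Fin using (Fin; zero; suc; toℕ; fromℕ<)
open import Data.Fin.Properties using (toℕ<n; toℕ-injective; toℕ-fromℕ<)
import Data.Fin.Properties as Fin
open import Data.Fin.Permutation using (Permutation′; _⟨$⟩ʳ_; _⟨$⟩ˡ_; inverseʳ; flip)
open import Data.Fin.Subset using (Subset; ⊤; ∣_∣; _∩_)
open import Data.List using ([]; _∷_; _∷ʳ_; length; filterᵇ; allFin; upTo; foldr)
import Data.List as List
open import Data.List.Properties using (upTo-∷ʳ)
open import Data.List.Membership.Propositional using (lose)
open import Data.List.Membership.Propositional.Properties using (∈-allFin)
open import Data.List.Relation.Unary.Any using (satisfied)
open import Data.List.Relation.Unary.Any.Properties using (any⁺; any⁻)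
open import Data.Vec using ([]; _∷_; lookup)
open import Data.Vec.Properties using (lookup-zipWith; lookup∘tabulate)
open import Algebra.Properties.CommutativeSemigroup +-commutativeSemigroup
  using (xy∙z≈xz∙y; x∙yz≈y∙xz; interchange)
open import Algebra.Properties.CommutativeMonoid.Sum +-0-commutativeMonoid
  using (sum; sum-cong-≗; ∑-distrib-+; sum-permute)
open import Relation.Binary.Bundles using (Setoid)
import Relation.Binary.Reasoning.Setoid as SetoidReasoning
open import Relation.Binary.PropositionalEquality
open import Relation.Nullary using (¬_; yes; no)
open import Relation.Nullary.Reflects using (ofʸ; ofⁿ; det)

open import Defs

module _ {m n : ℕ} where

  <ᵇ-true : m < n → (m <ᵇ n) ≡ true
  <ᵇ-true = det (<ᵇ-reflects-< m n) ∘ ofʸ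

  <ᵇ-false : ¬ m < n → (m <ᵇ n) ≡ false
  <ᵇ-false = det (<ᵇ-reflects-< m n) ∘ ofⁿ

  <ᵇ-sound : (m <ᵇ n) ≡ true → m < n
  <ᵇ-sound = <ᵇ⇒< m n ∘ Equivalence.from T-≡

  ≤ᵇ-true : m ≤ n → (m ≤ᵇ n) ≡ true
  ≤ᵇ-true = det (≤ᵇ-reflects-≤ m n) ∘ ofʸ

  ≤ᵇ-false : ¬ m ≤ n → (m ≤ᵇ n) ≡ false
  ≤ᵇ-false = det (≤ᵇ-reflects-≤ m n) ∘ ofⁿ

  ≤ᵇ-sound : (m ≤ᵇ n) ≡ true → m ≤ n
  ≤ᵇ-sound = ≤ᵇ⇒≤ m n ∘ Equivalence.from T-≡

≤ᵇ≡not<ᵇ : ∀ m n → (m ≤ᵇ n) ≡ not (n <ᵇ m)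
≤ᵇ≡not<ᵇ m n with n <ᵇ m | <ᵇ-reflects-< n m
... | true  | ofʸ n<m = ≤ᵇ-false (<⇒≱ n<m)
... | false | ofⁿ n≮m = ≤ᵇ-true (≮⇒≥ n≮m)

infix 4 _≡_mod_

_≡_mod_ : ℕ → ℕ → ℕ → Set
_≡_mod_ m m′ n = ∃₂ λ k k′ → m + k * n ≡ m′ + k′ * n

module _ {n : ℕ} where

  ≡-mod-refl : ∀ {m} → m ≡ m mod n
  ≡-mod-refl = 0 , 0 , refl

  ≡-mod-sym : ∀ {m m′} → m ≡ m′ mod n → m′ ≡ m mod n
  ≡-mod-sym (k , k′ , eq) = k′ , k , sym eq

  ≡-mod-trans : ∀ {m m′ m″} → m ≡ m′ mod n → m′ ≡ m″ mod n → m ≡ m″ mod n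
  ≡-mod-trans {m} {m′} {m″} (k , k′ , eq₁) (l , l′ , eq₂) = k + l , l′ + k′ , (begin
    m + (k + l) * n      ≡⟨ regroup m k l ⟩
    m + k * n + l * n    ≡⟨ cong (_+ l * n) eq₁ ⟩
    m′ + k′ * n + l * n  ≡⟨ swap m′ k′ l ⟩
    m′ + l * n + k′ * n  ≡⟨ cong (_+ k′ * n) eq₂ ⟩
    m″ + l′ * n + k′ * n ≡⟨ regroup m″ l′ k′ ⟨
    m″ + (l′ + k′) * n   ∎)
    where
    open ≡-Reasoning
    regroup : ∀ x i j → x + (i + j) * n ≡ x + i * n + j * n
    regroup x i j = trans (cong (x +_) (*-distribʳ-+ n i j)) (sym (+-assoc x (i * n) (j * n)))
    swap : ∀ x i j → x + i * n + j * n ≡ x + j * n + i * n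
    swap x i j = xy∙z≈xz∙y x (i * n) (j * n)

  ≡⇒≡-mod : ∀ {m m′} → m ≡ m′ → m ≡ m′ mod n
  ≡⇒≡-mod refl = ≡-mod-refl

  ≡-mod-+ʳ : ∀ d {m m′} → m ≡ m′ mod n → m + d ≡ m′ + d mod n
  ≡-mod-+ʳ d {m} {m′} (k , k′ , eq) = k , k′ , (begin
    m + d + k * n   ≡⟨ xy∙z≈xz∙y m d (k * n) ⟩
    m + k * n + d   ≡⟨ cong (_+ d) eq ⟩
    m′ + k′ * n + d ≡⟨ xy∙z≈xz∙y m′ (k′ * n) d ⟩
    m′ + d + k′ * n ∎)
    where open ≡-Reasoning

  ≡-mod-cancelˡ : ∀ d {m m′} → d + m ≡ d + m′ mod n → m ≡ m′ mod n
  ≡-mod-cancelˡ d {m} {m′} (k , k′ , eq) = k , k′ ,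
    +-cancelˡ-≡ d _ _ (trans (sym (+-assoc d m (k * n))) (trans eq (+-assoc d m′ (k′ * n))))

  +-period : ∀ m → n + m ≡ m mod n
  +-period m = 0 , 1 , trans (+-identityʳ (n + m)) (trans (+-comm n m) (cong (m +_) (sym (+-identityʳ n))))

  ≡-mod-< : ∀ {m m′} → m < n → m′ < n → m ≡ m′ mod n → m ≡ m′
  ≡-mod-< m<n m′<n (k , k′ , eq) = go m<n m′<n k k′ eq
    where
    shift : ∀ x y → x + (n + y) ≡ n + (x + y)
    shift x y = x∙yz≈y∙xz x n y
    go : ∀ {m m′} → m < n → m′ < n → ∀ k k′ → m + k * n ≡ m′ + k′ * n → m ≡ m′
    go {m} {m′} _ _ zero zero eq = trans (sym (+-identityʳ m)) (trans eq (+-identityʳ m′))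
    go {m} {m′} m<n m′<n (suc k) (suc k′) eq =
      go m<n m′<n k k′ (+-cancelˡ-≡ n _ _ (trans (sym (shift m (k * n))) (trans eq (shift m′ (k′ * n)))))
    go {m} {m′} m<n _ zero (suc k′) eq = ⊥-elim (<⇒≱ m<n (begin
      n                    ≤⟨ m≤m+n n (k′ * n) ⟩
      n + k′ * n           ≤⟨ m≤n+m (n + k′ * n) m′ ⟩
      m′ + (n + k′ * n)    ≡⟨ eq ⟨
      m + 0                ≡⟨ +-identityʳ m ⟩
      m                    ∎))
      where open ≤-Reasoning
    go m<n m′<n (suc k) zero eq = sym (go m′<n m<n zero (suc k) (sym eq))

≡-mod-setoid : ℕ → Setoid 0ℓ 0ℓ
≡-mod-setoid n = record
  { Carrier       = ℕ
  ; _≈_           = λ m m′ → m ≡ m′ mod n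
  ; isEquivalence = record { refl = ≡-mod-refl ; sym = ≡-mod-sym ; trans = ≡-mod-trans }
  }

-- pos {n} i j unfolds to cycGap n (toℕ i) (toℕ j).
cycGap : ℕ → ℕ → ℕ → ℕ
cycGap n y z = if y ≤ᵇ z then z ∸ y else (n ∸ y) + z

module _ {n : ℕ} where

  cycGap-≤ : ∀ {y z} → y ≤ z → cycGap n y z ≡ z ∸ y
  cycGap-≤ y≤z rewrite ≤ᵇ-true y≤z = refl

  cycGap-> : ∀ {y z} → z < y → cycGap n y z ≡ (n ∸ y) + z
  cycGap-> z<y rewrite ≤ᵇ-false (<⇒≱ z<y) = refl

  cycGap-< : ∀ {y z} → y < n → z < n → cycGap n y z < n
  cycGap-< {y} {z} y<n z<n with y ≤? z
  ... | yes y≤z rewrite cycGap-≤ y≤z = ≤-<-trans (m∸n≤m z y) z<n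
  ... | no y≰z rewrite cycGap-> (≰⇒> y≰z) = begin-strict
    (n ∸ y) + z <⟨ +-monoʳ-< (n ∸ y) (≰⇒> y≰z) ⟩
    (n ∸ y) + y ≡⟨ m∸n+n≡m (<⇒≤ y<n) ⟩
    n           ∎
    where open ≤-Reasoning

  cycGap-correct : ∀ {y} z → y < n → y + cycGap n y z ≡ z mod n
  cycGap-correct {y} z y<n with y ≤? z
  ... | yes y≤z rewrite cycGap-≤ y≤z = ≡⇒≡-mod (m+[n∸m]≡n y≤z)
  ... | no y≰z rewrite cycGap-> (≰⇒> y≰z) =
    ≡-mod-trans (≡⇒≡-mod (trans (sym (+-assoc y (n ∸ y) z)) (cong (_+ z) (m+[n∸m]≡n (<⇒≤ y<n)))))
                (+-period z)

  cycGap-unique : ∀ {y z d} → y < n → z < n → d < n → y + d ≡ z mod n → cycGap n y z ≡ d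
  cycGap-unique {y} {z} y<n z<n d<n eq = ≡-mod-< (cycGap-< y<n z<n) d<n
    (≡-mod-cancelˡ y (≡-mod-trans (cycGap-correct z y<n) (≡-mod-sym eq)))

  cycGap-self : ∀ y → cycGap n y y ≡ 0
  cycGap-self y = trans (cycGap-≤ (≤-refl {y})) (n∸n≡0 y)

  cycGap-comp : ∀ {w x y} → w < n → x < n → y < n →
                cycGap n (cycGap n w x) (cycGap n w y) ≡ cycGap n x y
  cycGap-comp {w} {x} {y} w<n x<n y<n =
    cycGap-unique (cycGap-< w<n x<n) (cycGap-< w<n y<n) (cycGap-< x<n y<n) (≡-mod-cancelˡ w (begin
      w + (wx + xy) ≈⟨ ≡⇒≡-mod (+-assoc w wx xy) ⟨
      w + wx + xy   ≈⟨ ≡-mod-+ʳ xy (cycGap-correct x w<n) ⟩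
      x + xy        ≈⟨ cycGap-correct y x<n ⟩
      y             ≈⟨ cycGap-correct y w<n ⟨
      w + wy        ∎))
    where
    open SetoidReasoning (≡-mod-setoid n)
    wx = cycGap n w x
    wy = cycGap n w y
    xy = cycGap n x y

  cycGap-injective : ∀ {y z z′} → y < n → z < n → z′ < n → cycGap n y z ≡ cycGap n y z′ → z ≡ z′
  cycGap-injective {y} {z} {z′} y<n z<n z′<n eq = ≡-mod-< z<n z′<n (≡-mod-trans
    (≡-mod-sym (cycGap-correct z y<n))
    (subst (λ g → y + g ≡ z′ mod n) (sym eq) (cycGap-correct z′ y<n)))

  cycGap-surjective : ∀ {y t} → y < n → t < n → ∃ λ z → z < n × cycGap n y z ≡ t
  cycGap-surjective {y} {t} y<n t<n with y + t <? n
  ... | yes y+t<n = y + t , y+t<n , cycGap-unique y<n y+t<n t<n ≡-mod-refl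
  ... | no  y+t≮n = z , z<n , cycGap-unique y<n z<n t<n
          (≡-mod-trans (≡⇒≡-mod (sym (m+[n∸m]≡n n≤y+t))) (+-period z))
    where
    n≤y+t = ≮⇒≥ y+t≮n
    z = y + t ∸ n
    z<n : z < n
    z<n = +-cancelˡ-< n z n (begin-strict
      n + z ≡⟨ m+[n∸m]≡n n≤y+t ⟩
      y + t <⟨ +-mono-< y<n t<n ⟩
      n + n ∎)
      where open ≤-Reasoning

module _ {n : ℕ} where

  pos-< : (i j : Fin n) → pos i j < n
  pos-< i j = cycGap-< (toℕ<n i) (toℕ<n j)

  pos-injective : (i : Fin n) {j j′ : Fin n} → pos i j ≡ pos i j′ → j ≡ j′
  pos-injective i {j} {j′} eq = toℕ-injective (cycGap-injective (toℕ<n i) (toℕ<n j) (toℕ<n j′) eq)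

  pos-self : (i : Fin n) → pos i i ≡ 0
  pos-self i = cycGap-self (toℕ i)

  pos-surjective : (i : Fin n) {t : ℕ} → t < n → ∃ λ j → pos i j ≡ t
  pos-surjective i t<n with cycGap-surjective (toℕ<n i) t<n
  ... | z , z<n , eq = fromℕ< z<n , trans (cong (cycGap n (toℕ i)) (toℕ-fromℕ< z<n)) eq

  pos-rebase : (a s x : Fin n) → pos s x ≡ cycGap n (pos a s) (pos a x)
  pos-rebase a s x = sym (cycGap-comp (toℕ<n a) (toℕ<n s) (toℕ<n x))

  module _ (a : Fin n) {s x : Fin n} where

    pos-shift : pos a s ≤ pos a x → pos s x ≡ pos a x ∸ pos a s
    pos-shift as≤ax = trans (pos-rebase a s x) (cycGap-≤ as≤ax)

    pos-wrap : pos a x < pos a s → pos s x ≡ (n ∸ pos a s) + pos a x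
    pos-wrap ax<as = trans (pos-rebase a s x) (cycGap-> ax<as)

  pos-mono : (a : Fin n) {s x y : Fin n} → pos a s ≤ pos a x → pos a x ≤ pos a y → pos s x ≤ pos s y
  pos-mono a {s} {x} {y} as≤ax ax≤ay = begin
    pos s x           ≡⟨ pos-shift a as≤ax ⟩
    pos a x ∸ pos a s ≤⟨ ∸-monoˡ-≤ (pos a s) ax≤ay ⟩
    pos a y ∸ pos a s ≡⟨ pos-shift a (≤-trans as≤ax ax≤ay) ⟨
    pos s y           ∎
    where open ≤-Reasoning

bit : Bool → ℕ
bit true  = 1
bit false = 0

bit-split : ∀ a b → bit a ≡ bit (a ∧ b) + bit (a ∧ not b)
bit-split false _     = refl
bit-split true  false = refl
bit-split true  true  = refl

count : ∀ {n} → (Fin n → Bool) → ℕ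
count f = sum (bit ∘ f)

module _ {n : ℕ} where

  count-cong : {f g : Fin n → Bool} → (∀ j → f j ≡ g j) → count f ≡ count g
  count-cong f≗g = sum-cong-≗ (cong bit ∘ f≗g)

  count-split : (f g : Fin n → Bool) → count f ≡ count (λ j → f j ∧ g j) + count (λ j → f j ∧ not (g j))
  count-split f g = trans (sum-cong-≗ (λ j → bit-split (f j) (g j)))
                          (∑-distrib-+ (λ j → bit (f j ∧ g j)) (λ j → bit (f j ∧ not (g j))))

  count-permute : (σ : Permutation′ n) (f : Fin n → Bool) → count f ≡ count (f ∘ (σ ⟨$⟩ʳ_))
  count-permute σ f = sum-permute (bit ∘ f) σ

count-mono : ∀ {n} {f g : Fin n → Bool} → (∀ j → f j ≡ true → g j ≡ true) → count f ≤ count g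
count-mono {zero}          f⊆g = z≤n
count-mono {suc n} {f} {g} f⊆g = +-mono-≤ (bit-mono (f⊆g zero)) (count-mono (f⊆g ∘ suc))
  where
  bit-mono : ∀ {a b} → (a ≡ true → b ≡ true) → bit a ≤ bit b
  bit-mono {false} _   = z≤n
  bit-mono {true}  a⇒b rewrite a⇒b refl = ≤-refl

count-none : ∀ {n} {f : Fin n → Bool} → (∀ j → f j ≡ false) → count f ≡ 0
count-none {zero}      _      = refl
count-none {suc n} {f} f≡false rewrite f≡false zero = count-none (f≡false ∘ suc)

count-single : ∀ {n} (f : Fin n → Bool) (x : Fin n) → (∀ j → f j ≡ true → j ≡ x) → count f ≡ bit (f x)
count-single {suc n} f zero    only-x = trans (cong (bit (f zero) +_) (count-none outside)) (+-identityʳ _)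
  where
  outside : ∀ j → f (suc j) ≡ false
  outside j with f (suc j) in eq
  ... | true  with () ← only-x (suc j) eq
  ... | false = refl
count-single {suc n} f (suc x) only-x with f zero in eq
... | true  with () ← only-x zero eq
... | false = count-single (f ∘ suc) x (λ j fj → Fin.suc-injective (only-x (suc j) fj))

∣p∣≡count : ∀ {n} (p : Subset n) → ∣ p ∣ ≡ count (lookup p)
∣p∣≡count []          = refl
∣p∣≡count (true  ∷ p) = cong suc (∣p∣≡count p)
∣p∣≡count (false ∷ p) = ∣p∣≡count p

∣p∩q∣≡count : ∀ {n} (p q : Subset n) → ∣ p ∩ q ∣ ≡ count (λ j → lookup p j ∧ lookup q j)
∣p∩q∣≡count p q = trans (∣p∣≡count (p ∩ q)) (count-cong (λ j → lookup-zipWith _∧_ j p q))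

length-filterᵇ-tabulate : ∀ {A : Set} {n} (h : A → Bool) (g : Fin n → A) →
                          length (filterᵇ h (List.tabulate g)) ≡ count (h ∘ g)
length-filterᵇ-tabulate {n = zero}  h g = refl
length-filterᵇ-tabulate {n = suc n} h g with h (g zero)
... | true  = cong suc (length-filterᵇ-tabulate h (g ∘ suc))
... | false = length-filterᵇ-tabulate h (g ∘ suc)

module _ {n : ℕ} where

  any-allFin-true : (f : Fin n → Bool) {x : Fin n} → f x ≡ true → any f (allFin n) ≡ true
  any-allFin-true f {x} fx = Equivalence.to T-≡ (any⁺ f (lose (∈-allFin x) (Equivalence.from T-≡ fx)))

  any-allFin-witness : (f : Fin n → Bool) → any f (allFin n) ≡ true → ∃ λ x → f x ≡ true
  any-allFin-witness f eq with satisfied (any⁻ f (allFin n) (Equivalence.from T-≡ eq))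
  ... | x , fx = x , Equivalence.to T-≡ fx

  allB-false : (f : Fin n → Bool) {x : Fin n} → f x ≡ false → allB f ≡ false
  allB-false f fx = cong not (any-allFin-true (not ∘ f) (cong not fx))

  allB-true : (f : Fin n → Bool) → allB f ≡ true → ∀ x → f x ≡ true
  allB-true f all x with f x in fx
  ... | true  = refl
  ... | false with () ← trans (sym all) (allB-false f fx)

module Ranked {n : ℕ} (k : Fin n → ℕ) where

  inRange : ℕ → ℕ → Fin n → Bool
  inRange u v j = (u ≤ᵇ k j) ∧ (k j <ᵇ v)

  between : (Fin n → Bool) → ℕ → ℕ → ℕ
  between f u v = count (λ j → f j ∧ inRange u v j)

  below : (Fin n → Bool) → ℕ → ℕ
  below f = between f 0

  below-zero : ∀ f → below f 0 ≡ 0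
  below-zero f = count-none (λ j → ∧-zeroʳ (f j))

  below-all : (∀ j → k j < n) → ∀ f → below f n ≡ count f
  below-all k<n f = count-cong (λ j → trans (cong (f j ∧_) (<ᵇ-true (k<n j))) (∧-identityʳ (f j)))

  below-split : ∀ f {u v} → u ≤ v → below f v ≡ below f u + between f u v
  below-split f {u} {v} u≤v = trans (count-split (λ j → f j ∧ (k j <ᵇ v)) (λ j → k j <ᵇ u)) (cong₂ _+_
    (count-cong (λ j → trans (∧-assoc (f j) _ _) (cong (f j ∧_) (lower (k j)))))
    (count-cong (λ j → trans (∧-assoc (f j) _ _) (cong (f j ∧_) (upper (k j))))))
    where
    lower : ∀ m → (m <ᵇ v) ∧ (m <ᵇ u) ≡ (m <ᵇ u)
    lower m with m <ᵇ u | <ᵇ-reflects-< m u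
    ... | true  | ofʸ m<u = trans (∧-identityʳ _) (<ᵇ-true (<-≤-trans m<u u≤v))
    ... | false | ofⁿ _   = ∧-zeroʳ _
    upper : ∀ m → (m <ᵇ v) ∧ not (m <ᵇ u) ≡ (u ≤ᵇ m) ∧ (m <ᵇ v)
    upper m rewrite ≤ᵇ≡not<ᵇ u m = ∧-comm (m <ᵇ v) _

  module _ (k-injective : ∀ {i j} → k i ≡ k j → i ≡ j) where

    between-point : ∀ f {x t} → k x ≡ t → between f t (suc t) ≡ bit (f x)
    between-point f {x} {t} refl = trans (count-single _ x only-x) (cong bit (at-x (f x)))
      where
      only-x : ∀ j → f j ∧ inRange t (suc t) j ≡ true → j ≡ x
      only-x j eq = k-injective (≤-antisym (s≤s⁻¹ (<ᵇ-sound (∧-conicalʳ _ _ in-range)))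
                                           (≤ᵇ-sound (∧-conicalˡ _ _ in-range)))
        where in-range = ∧-conicalʳ (f j) _ eq
      at-x : ∀ b → b ∧ ((t ≤ᵇ t) ∧ (t <ᵇ suc t)) ≡ b
      at-x b rewrite ≤ᵇ-true (≤-refl {t}) | <ᵇ-true (n<1+n t) = ∧-identityʳ b

    below-suc : ∀ f {x t} → k x ≡ t → below f (suc t) ≡ below f t + bit (f x)
    below-suc f {t = t} kx≡t = trans (below-split f (n≤1+n t)) (cong (below f t +_) (between-point f kx≡t))

module _ {A : Set} (h : A → Bool) where

  length-filterᵇ-∷ʳ : ∀ xs x → length (filterᵇ h (xs ∷ʳ x)) ≡ length (filterᵇ h xs) + bit (h x)
  length-filterᵇ-∷ʳ [] x with h x
  ... | true  = refl
  ... | false = refl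
  length-filterᵇ-∷ʳ (y ∷ ys) x with h y
  ... | true  = cong suc (length-filterᵇ-∷ʳ ys x)
  ... | false = length-filterᵇ-∷ʳ ys x

  length-filterᵇ-filterᵇ : ∀ (g : A → Bool) xs →
    length (filterᵇ h (filterᵇ g xs)) ≡ length (filterᵇ (λ x → g x ∧ h x) xs)
  length-filterᵇ-filterᵇ g []       = refl
  length-filterᵇ-filterᵇ g (x ∷ xs) with g x
  ... | false = length-filterᵇ-filterᵇ g xs
  ... | true  with h x
  ...   | true  = cong suc (length-filterᵇ-filterᵇ g xs)
  ...   | false = length-filterᵇ-filterᵇ g xs

pointwiseLe-below : ∀ L xs ys → pointwiseLe xs ys ≡ true →
                    length (filterᵇ (_<ᵇ L) ys) ≤ length (filterᵇ (_<ᵇ L) xs)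
pointwiseLe-below L []       []       _  = z≤n
pointwiseLe-below L (x ∷ xs) (y ∷ ys) le
  with ih ← pointwiseLe-below L xs ys (∧-conicalʳ _ _ le)
     | x ≤ᵇ y in x≤ᵇy | y <ᵇ L in y<ᵇL | x <ᵇ L in x<ᵇL
... | true | true  | true  = s≤s ih
... | true | false | true  = m≤n⇒m≤1+n ih
... | true | false | false = ih
... | true | true  | false =
  ⊥-elim (not-¬ x<ᵇL (<ᵇ-true {x} {L} (≤-<-trans (≤ᵇ-sound {x} {y} x≤ᵇy) (<ᵇ-sound {y} {L} y<ᵇL))))

module _ {n : ℕ} (i : Fin n) where

  open Ranked (pos i)

  sortedPos-below : (X : Subset n) (L : ℕ) → length (filterᵇ (_<ᵇ L) (sortedPos i X)) ≡ below (lookup X) L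
  sortedPos-below X L = begin
    length (filterᵇ (_<ᵇ L) (filterᵇ present (upTo n)))
      ≡⟨ length-filterᵇ-filterᵇ (_<ᵇ L) present (upTo n) ⟩
    length (filterᵇ G (upTo n))
      ≡⟨ prefix n ≤-refl ⟩
    below F n
      ≡⟨ below-all (pos-< i) F ⟩
    below (lookup X) L ∎
    where
    open ≡-Reasoning
    present : ℕ → Bool
    present q = any (λ j → lookup X j ∧ (pos i j ≡ᵇ q)) (allFin n)
    G : ℕ → Bool
    G q = present q ∧ (q <ᵇ L)
    F : Fin n → Bool
    F j = lookup X j ∧ (pos i j <ᵇ L)

    present-at : ∀ {x t} → pos i x ≡ t → present t ≡ lookup X x
    present-at {x} {t} refl with lookup X x in Xx
    ... | true  = any-allFin-true (λ j → lookup X j ∧ (pos i j ≡ᵇ pos i x))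
                    (cong₂ _∧_ Xx (Equivalence.to T-≡ (≡⇒≡ᵇ (pos i x) _ refl)))
    ... | false with present t in present-t
    ...   | false = refl
    ...   | true  with any-allFin-witness _ present-t
    ...     | j , Xj∧at-t
      with refl ← pos-injective i {j} {x} (≡ᵇ⇒≡ _ _ (Equivalence.from T-≡ (∧-conicalʳ _ _ Xj∧at-t)))
      with () ← trans (sym Xx) (∧-conicalˡ _ _ Xj∧at-t)

    prefix : ∀ t → t ≤ n → length (filterᵇ G (upTo t)) ≡ below F t
    prefix zero    _   = sym (below-zero F)
    prefix (suc t) t<n with pos-surjective i t<n
    ... | x , px≡t = begin
      length (filterᵇ G (upTo (suc t)))          ≡⟨ cong (length ∘ filterᵇ G) (upTo-∷ʳ t) ⟨
      length (filterᵇ G (upTo t ∷ʳ t))           ≡⟨ length-filterᵇ-∷ʳ G (upTo t) t ⟩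
      length (filterᵇ G (upTo t)) + bit (G t)    ≡⟨ cong₂ _+_ (prefix t (<⇒≤ t<n)) (cong bit G-at-t) ⟩
      below F t + bit (F x)                      ≡⟨ below-suc (pos-injective i) F px≡t ⟨
      below F (suc t)                            ∎
      where
      G-at-t : G t ≡ F x
      G-at-t rewrite present-at px≡t | px≡t = refl

  galeLe-below : {X Y : Subset n} (L : ℕ) → galeLe i X Y ≡ true → below (lookup Y) L ≤ below (lookup X) L
  galeLe-below {X} {Y} L X≤Y = subst₂ _≤_ (sortedPos-below Y L) (sortedPos-below X L)
    (pointwiseLe-below L (sortedPos i X) (sortedPos i Y) X≤Y)

cw-count : ∀ {n} (D : DecPerm n) (A : Subset n) {a : Fin n} → lookup A a ≡ false →
           cw D A ≡ count (λ i → subsetB (Carrow D i) A)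
cw-count {n} D A a∉A rewrite allB-false (lookup A) a∉A =
  length-filterᵇ-tabulate (λ i → subsetB (Carrow D i) A) (λ i → i)

module WithoutColoops {n : ℕ} (D : DecPerm n) (noColoops : ∀ i → ¬ isColoop D i) where

  isMinus-col : ∀ j → isMinus (col D j) ≡ false
  isMinus-col j with col D j in col-j
  ... | c0  = refl
  ... | c+1 = refl
  ... | c-1 with π D ⟨$⟩ʳ j Fin.≟ j
  ...   | yes fixed = ⊥-elim (noColoops j (fixed , col-j))
  ...   | no moved with () ← trans (sym col-j) (Equivalence.from (col-spec D j) moved)

  Iset-lookup : ∀ s j → lookup (Iset D s) j ≡ lt_ s j (π D ⟨$⟩ˡ j)
  Iset-lookup s j rewrite lookup∘tabulate (λ j → lt_ s j (π D ⟨$⟩ˡ j) ∨ isMinus (col D j)) j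
                        | isMinus-col j = ∨-identityʳ _

  Carrow-lookup : ∀ i x → lookup (Carrow D i) x ≡ le_ i x (π D ⟨$⟩ʳ i)
  Carrow-lookup i x rewrite isMinus-col i | ∧-zeroʳ (toℕ (π D ⟨$⟩ʳ i) ≡ᵇ toℕ i) =
    lookup∘tabulate (λ j → le_ i j (π D ⟨$⟩ʳ i)) x

  Carrow⊆-covers : ∀ {A : Subset n} {i x} → subsetB (Carrow D i) A ≡ true →
                   pos i x ≤ pos i (π D ⟨$⟩ʳ i) → lookup A x ≡ true
  Carrow⊆-covers {A} {i} {x} C⊆A x≤πi
    with allB-true (λ j → not (lookup (Carrow D i) j) ∨ lookup A j) C⊆A x
  ... | covered rewrite Carrow-lookup i x | ≤ᵇ-true x≤πi = covered

module Run {n : ℕ} (D : DecPerm n) (noColoops : ∀ i → ¬ isColoop D i)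
           (A : Subset n) (a : Fin n) (a∉A : lookup A a ≡ false) where

  open WithoutColoops D noColoops

  p : Fin n → ℕ
  p = pos a

  open Ranked p

  origin : Fin n → Fin n
  origin j = π D ⟨$⟩ˡ j

  arrowIn : Fin n → Bool
  arrowIn j = subsetB (Carrow D (origin j)) A

  arrowIn-covers : ∀ {j x} → arrowIn j ≡ true → pos (origin j) x ≤ pos (origin j) j → lookup A x ≡ true
  arrowIn-covers {j} {x} C⊆A x≤j =
    Carrow⊆-covers {A} C⊆A (subst (λ y → pos (origin j) x ≤ pos (origin j) y) (sym (inverseʳ (π D))) x≤j)

  arrowIn⇒∈A : ∀ {j} → arrowIn j ≡ true → lookup A j ≡ true
  arrowIn⇒∈A C⊆A = arrowIn-covers C⊆A ≤-refl

  arrowIn-origin≤ : ∀ {j} → arrowIn j ≡ true → p (origin j) ≤ p j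
  arrowIn-origin≤ {j} C⊆A with p (origin j) ≤? p j
  ... | yes ≤j = ≤j
  ... | no  ≰j = ⊥-elim (not-¬ a∉A (arrowIn-covers C⊆A (begin
    pos (origin j) a         ≡⟨ pos-wrap a a<origin ⟩
    (n ∸ p (origin j)) + p a ≡⟨ cong ((n ∸ p (origin j)) +_) (pos-self a) ⟩
    (n ∸ p (origin j)) + 0   ≤⟨ +-monoʳ-≤ (n ∸ p (origin j)) z≤n ⟩
    (n ∸ p (origin j)) + p j ≡⟨ pos-wrap a (≰⇒> ≰j) ⟨
    pos (origin j) j         ∎)))
    where
    open ≤-Reasoning
    a<origin : p a < p (origin j)
    a<origin = subst (_< p (origin j)) (sym (pos-self a)) (≤-<-trans z≤n (≰⇒> ≰j))

  arrowIn-after-gap : ∀ {j e} → arrowIn j ≡ true → lookup A e ≡ false → p e < p j → p e < p (origin j)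
  arrowIn-after-gap {j} {e} C⊆A e∉A e<j with p e <? p (origin j)
  ... | yes e<origin = e<origin
  ... | no  e≮origin = ⊥-elim (not-¬ e∉A (arrowIn-covers C⊆A (pos-mono a (≮⇒≥ e≮origin) (<⇒≤ e<j))))

  arrowIn∉Iset : ∀ {j e s} → arrowIn j ≡ true → lookup A e ≡ false → p s ≡ suc (p e) → p s ≤ p j →
                 lookup (Iset D s) j ≡ false
  arrowIn∉Iset {j} {e} {s} C⊆A e∉A s≡e+1 s≤j = trans (Iset-lookup s j) (<ᵇ-false (≤⇒≯ (pos-mono a
    (subst (_≤ p (origin j)) (sym s≡e+1) (arrowIn-after-gap C⊆A e∉A (subst (_≤ p j) s≡e+1 s≤j)))
    (arrowIn-origin≤ C⊆A))))

  inRange-rebase : ∀ s j {v} → v ≤ n → (pos s j <ᵇ v ∸ p s) ≡ inRange (p s) v j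
  inRange-rebase s j {v} v≤n with p s ≤? p j
  ... | yes s≤j rewrite pos-shift a s≤j | ≤ᵇ-true s≤j with p j <? v
  ...   | yes j<v = trans (<ᵇ-true (∸-monoˡ-< j<v s≤j)) (sym (<ᵇ-true j<v))
  ...   | no  j≮v = trans (<ᵇ-false (≤⇒≯ (∸-monoˡ-≤ (p s) (≮⇒≥ j≮v)))) (sym (<ᵇ-false j≮v))
  inRange-rebase s j {v} v≤n | no s≰j rewrite pos-wrap a (≰⇒> s≰j) | ≤ᵇ-false s≰j =
    <ᵇ-false (≤⇒≯ (≤-trans (∸-monoˡ-≤ (p s) v≤n) (m≤m+n (n ∸ p s) (p j))))

  arrowIn-false : ∀ {x} → lookup A x ≡ false → arrowIn x ≡ false
  arrowIn-false {x} x∉A with arrowIn x in C⊆A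
  ... | true  = ⊥-elim (not-¬ x∉A (arrowIn⇒∈A C⊆A))
  ... | false = refl

  last-gap : ∀ t → 0 < t → t ≤ n →
             ∃ λ e → lookup A e ≡ false × p e < t ×
                     (∀ j → suc (p e) ≤ p j → p j < t → lookup A j ≡ true)
  last-gap (suc zero) _ _ = a , a∉A , s≤s (≤-reflexive (pos-self a)) ,
    λ j a<j j<1 → ⊥-elim (n≮0 (≤-trans a<j (s≤s⁻¹ j<1)))
  last-gap (suc (suc t)) _ t+1<n with last-gap (suc t) (s≤s z≤n) (<⇒≤ t+1<n) | pos-surjective a t+1<n
  ... | e , e∉A , e≤t , run⊆A | x , x≡t+1 with lookup A x in Ax
  ...   | false = x , Ax , s≤s (≤-reflexive x≡t+1) ,
          λ j x<j j<t+2 → ⊥-elim (<⇒≱ x<j (subst (p j ≤_) (sym x≡t+1) (s≤s⁻¹ j<t+2)))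
  ...   | true  = e , e∉A , m≤n⇒m≤1+n e≤t , extended
    where
    extended : ∀ j → suc (p e) ≤ p j → p j < suc (suc t) → lookup A j ≡ true
    extended j e<j j<t+2 with p j <? suc t
    ... | yes j<t+1 = run⊆A j e<j j<t+1
    ... | no  j≮t+1
      with refl ← pos-injective a (trans (≤-antisym (s≤s⁻¹ j<t+2) (≮⇒≥ j≮t+1)) (sym x≡t+1)) = Ax

  below-rebase : ∀ f s {v} → v ≤ n → Ranked.below (pos s) f (v ∸ p s) ≡ between f (p s) v
  below-rebase f s v≤n = count-cong (λ j → cong (f j ∧_) (inRange-rebase s j v≤n))

  arrowIn-between : ∀ {e s v} → lookup A e ≡ false → p s ≡ suc (p e) →
                    between arrowIn (p s) v ≤ count (λ j → inRange (p s) v j ∧ not (lookup (Iset D s) j))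
  arrowIn-between {e} {s} {v} e∉A s≡e+1 = count-mono outside-Iset
    where
    outside-Iset : ∀ j → arrowIn j ∧ inRange (p s) v j ≡ true →
                   inRange (p s) v j ∧ not (lookup (Iset D s) j) ≡ true
    outside-Iset j arrowIn∧R with ∧-conicalˡ (arrowIn j) _ arrowIn∧R | ∧-conicalʳ (arrowIn j) _ arrowIn∧R
    ... | C⊆A | inR
      rewrite arrowIn∉Iset C⊆A e∉A s≡e+1 (≤ᵇ-sound {p s} {p j} (∧-conicalˡ (p s ≤ᵇ p j) _ inR)) =
        trans (∧-identityʳ _) inR

  module _ (B : Subset n) (B-basis : isBasis D B ≡ true) where

    A∩B : Fin n → Bool
    A∩B j = lookup A j ∧ lookup B j

    basis-between : ∀ s {v} → v ≤ n → between (lookup B) (p s) v ≤ between (lookup (Iset D s)) (p s) v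
    basis-between s {v} v≤n = subst₂ _≤_ (below-rebase (lookup B) s v≤n) (below-rebase (lookup (Iset D s)) s v≤n)
      (galeLe-below s {Iset D s} {B} (v ∸ p s) (allB-true _ B-basis s))

    run-bound : ∀ {e s v} → lookup A e ≡ false → p s ≡ suc (p e) → v ≤ n →
                (∀ j → p s ≤ p j → p j < v → lookup A j ≡ true) →
                between A∩B (p s) v + between arrowIn (p s) v ≤ between (lookup A) (p s) v
    run-bound {e} {s} {v} e∉A s≡e+1 v≤n run⊆A = begin
      between A∩B (p s) v + between arrowIn (p s) v
        ≤⟨ +-mono-≤ (≤-trans A∩B≤B (basis-between s v≤n)) (arrowIn-between {v = v} e∉A s≡e+1) ⟩
      count (λ j → I j ∧ R j) + count (λ j → R j ∧ not (I j))
        ≡⟨ cong (_+ count (λ j → R j ∧ not (I j))) (count-cong (λ j → ∧-comm (I j) (R j))) ⟩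
      count (λ j → R j ∧ I j) + count (λ j → R j ∧ not (I j))
        ≡⟨ count-split R I ⟨
      count R
        ≡⟨ count-cong R≡A∧R ⟩
      between (lookup A) (p s) v ∎
      where
      open ≤-Reasoning
      R : Fin n → Bool
      R = inRange (p s) v
      I : Fin n → Bool
      I = lookup (Iset D s)
      A∩B≤B : between A∩B (p s) v ≤ between (lookup B) (p s) v
      A∩B≤B = count-mono (λ j A∩B∧R →
        ∧-conicalʳ (lookup A j) _ (trans (sym (∧-assoc (lookup A j) _ _)) A∩B∧R))
      R≡A∧R : ∀ j → R j ≡ lookup A j ∧ R j
      R≡A∧R j with R j in inR
      ... | true  rewrite run⊆A j (≤ᵇ-sound {p s} {p j} (∧-conicalˡ (p s ≤ᵇ p j) _ inR))
                                 (<ᵇ-sound {p j} {v} (∧-conicalʳ (p s ≤ᵇ p j) _ inR)) = refl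
      ... | false = sym (∧-zeroʳ _)

    Balanced : ℕ → Set
    Balanced t = below A∩B t + below arrowIn t ≤ below (lookup A) t

    balanced-zero : Balanced 0
    balanced-zero rewrite below-zero A∩B | below-zero arrowIn | below-zero (lookup A) = z≤n

    balanced-gap : ∀ {x t} → p x ≡ t → lookup A x ≡ false → Balanced t → Balanced (suc t)
    balanced-gap {x} {t} x≡t x∉A balanced
      rewrite below-suc (pos-injective a) A∩B x≡t | below-suc (pos-injective a) arrowIn x≡t
            | below-suc (pos-injective a) (lookup A) x≡t | x∉A | arrowIn-false x∉A
            | +-identityʳ (below A∩B t) | +-identityʳ (below arrowIn t) | +-identityʳ (below (lookup A) t)
      = balanced

    balanced-run : ∀ {e v} → lookup A e ≡ false → suc (p e) ≤ v → v ≤ n →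
                   (∀ j → suc (p e) ≤ p j → p j < v → lookup A j ≡ true) →
                   Balanced (suc (p e)) → Balanced v
    balanced-run {e} {v} e∉A e<v v≤n run⊆A balanced with suc (p e) <? n
    ... | no e+1≮n rewrite ≤-antisym (≤-trans v≤n (≮⇒≥ e+1≮n)) e<v = balanced
    ... | yes e+1<n with pos-surjective a e+1<n
    ...   | s , s≡e+1 = begin
      below A∩B v + below arrowIn v
        ≡⟨ cong₂ _+_ (below-split A∩B e<v) (below-split arrowIn e<v) ⟩
      (below A∩B u + between A∩B u v) + (below arrowIn u + between arrowIn u v)
        ≡⟨ interchange (below A∩B u) (between A∩B u v) (below arrowIn u) (between arrowIn u v) ⟩
      (below A∩B u + below arrowIn u) + (between A∩B u v + between arrowIn u v)
        ≤⟨ +-mono-≤ balanced run ⟩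
      below (lookup A) u + between (lookup A) u v
        ≡⟨ below-split (lookup A) e<v ⟨
      below (lookup A) v ∎
      where
      open ≤-Reasoning
      u = suc (p e)
      run : between A∩B u v + between arrowIn u v ≤ between (lookup A) u v
      run = subst (λ w → between A∩B w v + between arrowIn w v ≤ between (lookup A) w v) s≡e+1
              (run-bound e∉A s≡e+1 v≤n (λ j s≤j → run⊆A j (subst (_≤ p j) s≡e+1 s≤j)))

    balanced : ∀ t → t ≤ n → Balanced t
    balanced = <-rec (λ t → t ≤ n → Balanced t) step
      where
      step : ∀ t → (∀ {u} → u < t → u ≤ n → Balanced u) → t ≤ n → Balanced t
      step zero    _  _   = balanced-zero
      step (suc t) ih t<n with last-gap (suc t) (s≤s z≤n) t<n
      ... | e , e∉A , e<t+1 , run⊆A =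
        balanced-run e∉A e<t+1 t<n run⊆A (balanced-gap {e} refl e∉A (ih e<t+1 (≤-trans (<⇒≤ e<t+1) t<n)))

    basis-bound : count A∩B + count arrowIn ≤ count (lookup A)
    basis-bound = subst₂ _≤_ (cong₂ _+_ (below-all (pos-< a) A∩B) (below-all (pos-< a) arrowIn))
                             (below-all (pos-< a) (lookup A)) (balanced n ≤-refl)

rk-lub : ∀ {n} (D : DecPerm n) (S : Subset n) {m : ℕ} →
         (∀ B → isBasis D B ≡ true → ∣ S ∩ B ∣ ≤ m) → rk D S ≤ m
rk-lub {n} D S {m} bound = lub (allSubsets n)
  where
  candidate : ∀ B → (if isBasis D B then ∣ S ∩ B ∣ else 0) ≤ m
  candidate B with isBasis D B in B-basis
  ... | true  = bound B B-basis
  ... | false = z≤n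
  lub : ∀ Bs → foldr (λ B r → (if isBasis D B then ∣ S ∩ B ∣ else 0) ⊔ r) 0 Bs ≤ m
  lub []       = z≤n
  lub (B ∷ Bs) = ⊔-lub (candidate B) (lub Bs)

∃-outside : ∀ {n} (X : Subset n) → ¬ X ≡ ⊤ → ∃ λ x → lookup X x ≡ false
∃-outside []          X≢⊤ = ⊥-elim (X≢⊤ refl)
∃-outside (false ∷ X) _   = zero , refl
∃-outside (true  ∷ X) X≢⊤ with ∃-outside X (X≢⊤ ∘ cong (true ∷_))
... | x , x∉X = suc x , x∉X

lemma4p16 : (n : ℕ) (D : DecPerm n) → (∀ i → ¬ isColoop D i) →
    (A : Subset n) → ¬ (A ≡ ⊤) → rk D A + cw D A ≤ ∣ A ∣
lemma4p16 n D noColoops A A≢⊤ with ∃-outside A A≢⊤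
... | a , a∉A = begin
  rk D A + cw D A         ≤⟨ +-monoˡ-≤ (cw D A) (rk-lub D A (λ B → m+n≤o⇒m≤o∸n _ ∘ per-basis B)) ⟩
  ∣ A ∣ ∸ cw D A + cw D A ≡⟨ m∸n+n≡m cw≤∣A∣ ⟩
  ∣ A ∣                   ∎
  where
  open ≤-Reasoning
  open Run D noColoops A a a∉A
  cw≡count : cw D A ≡ count arrowIn
  cw≡count = trans (cw-count D A a∉A) (count-permute {n} (flip (π D)) (λ i → subsetB (Carrow D i) A))
  per-basis : ∀ B → isBasis D B ≡ true → ∣ A ∩ B ∣ + cw D A ≤ ∣ A ∣
  per-basis B B-basis rewrite ∣p∩q∣≡count A B | cw≡count | ∣p∣≡count A = basis-bound B B-basis
  cw≤∣A∣ : cw D A ≤ ∣ A ∣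
  cw≤∣A∣ rewrite cw≡count | ∣p∣≡count A = count-mono (λ j → arrowIn⇒∈A {j})
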